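{- Let $\mathcal F$ be a finite set of finite tournaments, each with at least two vertices, and let $n\le m_{\mathcal F}$ be a positive integer such that the transitive tournament $T_n$ is $\mathcal F$-free. The following are equivalent: (1) every tournament on $n$ vertices is $\mathcal F$-free; (2) $P_n=\{0,1\}^{\binom n2}$; (3) $P_n$ is preserved by the minimum operation; (4) $P_n$ is preserved by the maximum operation; (5) $P_n$ is preserved by the majority operation; (6) $P_n$ is preserved by the minority operation.
   Context: A tournament is a loopless digraph in which every two distinct vertices are joined by exactly one edge (in one direction); $T_n$ is the transitive tournament on $n$ vertices. A tournament is $\mathcal F$-free if no tournament of $\mathcal F$ embeds into it as an induced subdigraph. $m_{\mathcal F}$ is the maximum number of vertices of a tournament in $\mathcal F$. For a tournament $T$ on $\{1,\dots,n\}$, $b_T\in\{0,1\}^{\binom n2}$ is indexed by pairs $i<j$ with $(b_T)_{ij}=1$ iff $(i,j)\in E(T)$; $P_n=\{b_T: T$ an $\mathcal F$-free tournament on $\{1,\dots,n\}\}$. The minimum, maximum, majority and minority operations are the Boolean operations on $\{0,1\}$: $\min$, $\max$, the ternary $f$ with $f(x,x,y)=f(x,y,x)=f(y,x,x)=x$, and the ternary $f$ with $f(x,x,y)=f(x,y,x)=f(y,x,x)=y$. A relation $R\subseteq\{0,1\}^r$ is preserved by a $k$-ary operation $f$ if applying $f$ coordinatewise to any $k$ tuples of $R$ yields a tuple of $R$. -}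

module Defs where

open import Data.Nat as ℕ using (ℕ; _≤_; _⊔_)
open import Data.Fin using (Fin; toℕ; _<_)
open import Data.Nat.Base using (_<ᵇ_)
open import Data.Bool using (Bool; true; false; not; _∧_; _∨_; _xor_)
open import Data.Product using (Σ; ∃; ∃-syntax; _×_; _,_; proj₁; proj₂)
open import Data.List using (List; foldr)
open import Data.List.Relation.Unary.Any using (Any)
open import Relation.Binary.PropositionalEquality using (_≡_; _≢_; refl; cong)
open import Data.Empty using (⊥-elim)
open import Data.Fin.Properties using (toℕ-injective)
open import Relation.Nullary using (¬_)
open import Function.Definitions using (Injective)

record Tournament (n : ℕ) : Set where
  field
    adj      : Fin n → Fin n → Bool
    loopless : ∀ i → adj i i ≡ false
    oneEdge  : ∀ i j → i ≢ j → adj i j ≡ not (adj j i)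
open Tournament public

FinTournament : Set
FinTournament = Σ ℕ Tournament

Embeds : ∀ {k n} → Tournament k → Tournament n → Set
Embeds {k} {n} S T =
  Σ (Fin k → Fin n) λ f → Injective _≡_ _≡_ f ×
    (∀ i j → adj T (f i) (f j) ≡ adj S i j)

Family : Set
Family = List FinTournament

Free : ∀ {n} → Family → Tournament n → Set
Free F T = ¬ Any (λ S → Embeds (proj₂ S) T) F

mF : Family → ℕ
mF = foldr (λ S m → proj₁ S ⊔ m) 0

<ᵇ-irrefl : ∀ m → (m <ᵇ m) ≡ false
<ᵇ-irrefl ℕ.zero    = refl
<ᵇ-irrefl (ℕ.suc m) = <ᵇ-irrefl m

<ᵇ-asym : ∀ m n → m ≢ n → (m <ᵇ n) ≡ not (n <ᵇ m)
<ᵇ-asym ℕ.zero    ℕ.zero    m≢n = ⊥-elim (m≢n refl)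
<ᵇ-asym ℕ.zero    (ℕ.suc n) m≢n = refl
<ᵇ-asym (ℕ.suc m) ℕ.zero    m≢n = refl
<ᵇ-asym (ℕ.suc m) (ℕ.suc n) m≢n = <ᵇ-asym m n (λ e → m≢n (cong ℕ.suc e))

transitive : (n : ℕ) → Tournament n
transitive n = record
  { adj = λ i j → toℕ i <ᵇ toℕ j
  ; loopless = λ i → <ᵇ-irrefl (toℕ i)
  ; oneEdge = λ i j i≢j → <ᵇ-asym (toℕ i) (toℕ j) (λ e → i≢j (toℕ-injective e))
  }

Pair : ℕ → Set
Pair n = Σ (Fin n × Fin n) λ p → proj₁ p < proj₂ p

BVec : ℕ → Set
BVec n = Pair n → Bool

b : ∀ {n} → Tournament n → BVec n
b T ((i , j) , _) = adj T i j

InP : (F : Family) (n : ℕ) → BVec n → Set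
InP F n v = ∃[ T ] (Free F T × (∀ p → b T p ≡ v p))

Pfull : Family → ℕ → Set
Pfull F n = ∀ (v : BVec n) → InP F n v

Preserves₂ : (Bool → Bool → Bool) → Family → ℕ → Set
Preserves₂ f F n = ∀ (u v : BVec n) → InP F n u → InP F n v →
  InP F n (λ p → f (u p) (v p))

Preserves₃ : (Bool → Bool → Bool → Bool) → Family → ℕ → Set
Preserves₃ f F n = ∀ (u v w : BVec n) → InP F n u → InP F n v → InP F n w →
  InP F n (λ p → f (u p) (v p) (w p))

minOp : Bool → Bool → Bool
minOp = _∧_

maxOp : Bool → Bool → Bool
maxOp = _∨_

majority : Bool → Bool → Bool → Bool
majority x y z = (x ∧ y) ∨ (y ∧ z) ∨ (x ∧ z)

minority : Bool → Bool → Bool → Bool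
minority x y z = x xor y xor z

AllFree : Family → ℕ → Set
AllFree F n = ∀ (T : Tournament n) → Free F T

{-# OPTIONS --safe #-}
-- Relabellings of T_n are F-free, and their vectors include 1 − e, e and the constant
-- vectors 0 and 1, where e is the indicator of the pair {0,1}.  If P_n is preserved by
-- the operation, applying it to b_U and suitable such vectors gives b_U xor e, i.e. U with
-- the edge {0,1} reversed (for min and majority when that edge points 0 → 1, for max when
-- it points 1 → 0, for minority always).  Relabelling by a permutation, F-free tournaments
-- are closed under reversing any single edge, and reversing the edges of T_n one pair at a
-- time reaches every tournament on n vertices.
module Submission where

open import Defs
open import Data.Nat using (ℕ; _≤_)
open import Data.Nat.Base using (2+)
open import Data.Product using (_×_; proj₁)
open import Data.List.Relation.Unary.All using (All)
open import Function.Bundles using (_⇔_)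

open import Data.Bool using (Bool; true; false; not; _∧_; _∨_; _xor_)
import Data.Bool.Properties as Bool
open import Data.Empty using (⊥; ⊥-elim)
open import Data.Fin using (Fin; suc; toℕ; _<_; _<?_; opposite)
open import Data.Fin.Patterns using (0F; 1F)
open import Data.Fin.Permutation as Perm using (Permutation′; _⟨$⟩ʳ_; _⟨$⟩ˡ_; inverseʳ; _∘ₚ_)
import Data.Fin.Permutation.Components as PC
open import Data.Fin.Properties using (_≟_; <⇒≢; <-cmp; <-irrelevant; toℕ<n; opposite-prop; opposite-involutive)
open import Data.List using (List; []; _∷_; allFin; cartesianProduct)
open import Data.List.Membership.Propositional using (_∉_)
open import Data.List.Membership.Propositional.Properties using (∈-cartesianProduct⁺; ∈-allFin)
open import Data.List.Relation.Unary.Any as Any using (here; there)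
import Data.Nat as ℕ
import Data.Nat.Properties as ℕ
open import Data.Product using (Σ; _,_; proj₂)
open import Data.Product.Properties using (≡-dec)
open import Function using (Injection; Equivalence; _∘_; mk⇔)
open import Function.Definitions using (Injective)
open import Function.Properties.Inverse using (↔⇒↣)
open import Relation.Binary.Definitions using (tri<; tri≈; tri>)
open import Relation.Binary.PropositionalEquality
open import Relation.Nullary using (Dec; yes; no; does)
open import Relation.Nullary.Decidable using (dec-true; dec-false)
open import Relation.Nullary.Reflects using (det; fromEquivalence)

private
  variable
    k m n : ℕ
    F : Family

Embeds-trans : {R : Tournament k} {S : Tournament m} {T : Tournament n} →
  Embeds R S → Embeds S T → Embeds R T
Embeds-trans (f , f-inj , f-adj) (g , g-inj , g-adj) =
  g ∘ f , (λ e → f-inj (g-inj e)) , λ i j → trans (g-adj (f i) (f j)) (f-adj i j)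

Free-hereditary : {S : Tournament m} {T : Tournament n} → Embeds S T → Free F T → Free F S
Free-hereditary {S = S} {T} S↪T T-free F↪S =
  T-free (Any.map (λ {(_ , R)} R↪S → Embeds-trans {R = R} {S} {T} R↪S S↪T) F↪S)

induced : (T : Tournament n) (g : Fin k → Fin n) → Injective _≡_ _≡_ g → Tournament k
induced T g g-inj = record
  { adj      = λ i j → adj T (g i) (g j)
  ; loopless = λ i → loopless T (g i)
  ; oneEdge  = λ i j i≢j → oneEdge T (g i) (g j) (λ e → i≢j (g-inj e))
  }

Free-induced : {T : Tournament n} {g : Fin k → Fin n} (g-inj : Injective _≡_ _≡_ g) →
  Free F T → Free F (induced T g g-inj)
Free-induced {T = T} {g} g-inj =
  Free-hereditary {S = induced T g g-inj} {T} (g , g-inj , λ _ _ → refl)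

infix 4 _≈ᵀ_
_≈ᵀ_ : Tournament n → Tournament n → Set
T ≈ᵀ T′ = ∀ i j → adj T i j ≡ adj T′ i j

Free-resp-≈ᵀ : {T T′ : Tournament n} → T ≈ᵀ T′ → Free F T → Free F T′
Free-resp-≈ᵀ {T = T} {T′} T≈T′ = Free-hereditary {S = T′} {T = T} ((λ i → i) , (λ e → e) , T≈T′)

⟨$⟩ʳ-injective : (σ : Permutation′ n) → Injective _≡_ _≡_ (σ ⟨$⟩ʳ_)
⟨$⟩ʳ-injective σ = Injection.injective (↔⇒↣ σ)

permute : Tournament n → Permutation′ n → Tournament n
permute T σ = induced T (σ ⟨$⟩ʳ_) (⟨$⟩ʳ-injective σ)

Free-permute : (T : Tournament n) (σ : Permutation′ n) → Free F T → Free F (permute T σ)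
Free-permute T σ = Free-induced {T = T} (⟨$⟩ʳ-injective σ)

Free-unpermute : (T : Tournament n) (σ : Permutation′ n) → Free F (permute T σ) → Free F T
Free-unpermute T σ = Free-hereditary {S = T} {permute T σ}
  ( (σ ⟨$⟩ˡ_) , ⟨$⟩ʳ-injective (Perm.flip σ)
  , λ i j → cong₂ (adj T) (inverseʳ σ) (inverseʳ σ))

b-irrelevant : (v : BVec n) {i j : Fin n} (p q : i < j) → v ((i , j) , p) ≡ v ((i , j) , q)
b-irrelevant v p q = cong (λ r → v (_ , r)) (<-irrelevant p q)

b-injective : {T T′ : Tournament n} → (∀ p → b T p ≡ b T′ p) → T ≈ᵀ T′
b-injective {T = T} {T′} b≡ i j with <-cmp i j
... | tri< i<j _ _    = b≡ (_ , i<j)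
... | tri≈ _ refl _   = trans (loopless T i) (sym (loopless T′ i))
... | tri> _ i≢j j<i  = begin
  adj T i j        ≡⟨ oneEdge T i j i≢j ⟩
  not (adj T j i)  ≡⟨ cong not (b≡ (_ , j<i)) ⟩
  not (adj T′ j i) ≡⟨ oneEdge T′ i j i≢j ⟨
  adj T′ i j       ∎
  where open ≡-Reasoning

module _ (v : BVec n) where

  fromBVec-adj : Fin n → Fin n → Bool
  fromBVec-adj i j with <-cmp i j
  ... | tri< i<j _ _ = v (_ , i<j)
  ... | tri≈ _ _ _   = false
  ... | tri> _ _ j<i = not (v (_ , j<i))

  fromBVec-loopless : ∀ i → fromBVec-adj i i ≡ false
  fromBVec-loopless i with <-cmp i i
  ... | tri< _ i≢i _ = ⊥-elim (i≢i refl)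
  ... | tri≈ _ _ _   = refl
  ... | tri> _ i≢i _ = ⊥-elim (i≢i refl)

  fromBVec-oneEdge : ∀ i j → i ≢ j → fromBVec-adj i j ≡ not (fromBVec-adj j i)
  fromBVec-oneEdge i j i≢j with <-cmp i j | <-cmp j i
  ... | tri< i<j _ _ | tri> _ _ i<j′ = sym (trans (Bool.not-involutive _) (b-irrelevant v i<j′ i<j))
  ... | tri> _ _ j<i | tri< j<i′ _ _ = cong not (b-irrelevant v j<i j<i′)
  ... | tri< i<j _ _ | tri< j<i _ _  = ⊥-elim (ℕ.<-asym i<j j<i)
  ... | tri> _ _ j<i | tri> _ _ i<j  = ⊥-elim (ℕ.<-asym i<j j<i)
  ... | tri≈ _ i≡j _ | _             = ⊥-elim (i≢j i≡j)
  ... | _            | tri≈ _ j≡i _  = ⊥-elim (i≢j (sym j≡i))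

  fromBVec : Tournament n
  fromBVec = record { adj = fromBVec-adj ; loopless = fromBVec-loopless ; oneEdge = fromBVec-oneEdge }

  b-fromBVec : ∀ p → b fromBVec p ≡ v p
  b-fromBVec ((i , j) , i<j) with <-cmp i j
  ... | tri< i<j′ _ _ = b-irrelevant v i<j′ i<j
  ... | tri≈ _ i≡j _  = ⊥-elim (ℕ.<-irrefl (cong toℕ i≡j) i<j)
  ... | tri> _ _ j<i  = ⊥-elim (ℕ.<-asym i<j j<i)

InP⇒Free : {T : Tournament n} → InP F n (b T) → Free F T
InP⇒Free {F = F} {T = T} (T′ , T′-free , b≡) =
  Free-resp-≈ᵀ {F = F} {T = T′} {T} (b-injective {T = T′} {T} b≡) T′-free

Free⇒InP : {T : Tournament n} → Free F T → InP F n (b T)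
Free⇒InP {T = T} T-free = T , T-free , λ _ → refl

AllFree⇒Pfull : AllFree F n → Pfull F n
AllFree⇒Pfull all-free v = fromBVec v , all-free (fromBVec v) , b-fromBVec v

Pfull⇒AllFree : Pfull F n → AllFree F n
Pfull⇒AllFree {F = F} full T = InP⇒Free {F = F} {T = T} (full (b T))

infix 7 _==_
infix 4 _≟²_
_==_ : Fin n → Fin n → Bool
i == j = does (i ≟ j)

_≟²_ : (p q : Fin n × Fin n) → Dec (p ≡ q)
_≟²_ = ≡-dec _≟_ _≟_

==-∧-false : {i j x y : Fin n} → (i ≡ x → j ≡ y → ⊥) → (i == x ∧ j == y) ≡ false
==-∧-false {i = i} {j} {x} {y} ¬both with i ≟ x | j ≟ y
... | yes i≡x | yes j≡y = ⊥-elim (¬both i≡x j≡y)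
... | yes _   | no _    = refl
... | no _    | _       = refl

==-injective : {g : Fin k → Fin n} → Injective _≡_ _≡_ g →
  ∀ {x a} → g x ≡ a → ∀ i → (g i == a) ≡ (i == x)
==-injective {g = g} g-inj {x} {a} gx≡a i with g i ≟ a | i ≟ x
... | yes _    | yes _    = refl
... | no _     | no _     = refl
... | yes gi≡a | no i≢x   = ⊥-elim (i≢x (g-inj (trans gi≡a (sym gx≡a))))
... | no gi≢a  | yes refl = ⊥-elim (gi≢a gx≡a)

isEdge : (x y : Fin n) → Fin n → Fin n → Bool
isEdge x y i j = (i == x ∧ j == y) ∨ (i == y ∧ j == x)

isEdge-irrefl : {x y : Fin n} → x ≢ y → ∀ i → isEdge x y i i ≡ false
isEdge-irrefl {x = x} {y} x≢y i = cong₂ _∨_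
  (==-∧-false {i = i} {i} {x} {y} λ i≡x i≡y → x≢y (trans (sym i≡x) i≡y))
  (==-∧-false {i = i} {i} {y} {x} λ i≡y i≡x → x≢y (trans (sym i≡x) i≡y))

isEdge-sym : ∀ (x y i j : Fin n) → isEdge x y i j ≡ isEdge x y j i
isEdge-sym x y i j = trans (Bool.∨-comm (i == x ∧ j == y) _)
  (cong₂ _∨_ (Bool.∧-comm (i == y) _) (Bool.∧-comm (i == x) _))

isEdge-refl : ∀ (x y : Fin n) → isEdge x y x y ≡ true
isEdge-refl x y rewrite dec-true (x ≟ x) refl | dec-true (y ≟ y) refl = refl

isEdge-ordered : {i j x y : Fin n} → i < j → x < y → (i , j) ≢ (x , y) → isEdge x y i j ≡ false
isEdge-ordered {i = i} {j} {x} {y} i<j x<y ij≢xy = cong₂ _∨_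
  (==-∧-false {i = i} {j} {x} {y} λ { refl refl → ij≢xy refl })
  (==-∧-false {i = i} {j} {y} {x} λ { refl refl → ℕ.<-asym i<j x<y })

isEdge-ordered-true : {i j x y : Fin n} → i < j → x < y → isEdge x y i j ≡ true → (i , j) ≡ (x , y)
isEdge-ordered-true {i = i} {j} {x} {y} i<j x<y edge with (i , j) ≟² (x , y)
... | yes ij≡xy = ij≡xy
... | no ij≢xy with () ← trans (sym (isEdge-ordered i<j x<y ij≢xy)) edge

reverseEdge : (T : Tournament n) (x y : Fin n) → x ≢ y → Tournament n
reverseEdge T x y x≢y = record
  { adj      = λ i j → adj T i j xor isEdge x y i j
  ; loopless = λ i → cong₂ _xor_ (loopless T i) (isEdge-irrefl x≢y i)
  ; oneEdge  = λ i j i≢j → trans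
      (cong₂ _xor_ (oneEdge T i j i≢j) (isEdge-sym x y i j))
      (sym (Bool.not-distribˡ-xor (adj T j i) _))
  }

reverseEdge-involutive : (T : Tournament n) {x y : Fin n} (x≢y : x ≢ y) →
  reverseEdge (reverseEdge T x y x≢y) x y x≢y ≈ᵀ T
reverseEdge-involutive T {x} {y} _ i j = begin
  (adj T i j xor e) xor e ≡⟨ Bool.xor-assoc (adj T i j) e e ⟩
  adj T i j xor (e xor e) ≡⟨ cong (adj T i j xor_) (Bool.xor-same e) ⟩
  adj T i j xor false     ≡⟨ Bool.xor-identityʳ (adj T i j) ⟩
  adj T i j               ∎
  where
  open ≡-Reasoning
  e = isEdge x y i j

reverseEdge-comm : (T : Tournament n) {x y : Fin n} (x≢y : x ≢ y) (y≢x : y ≢ x) →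
  reverseEdge T y x y≢x ≈ᵀ reverseEdge T x y x≢y
reverseEdge-comm T {x} {y} _ _ i j = cong (adj T i j xor_) (Bool.∨-comm (i == y ∧ j == x) _)

induced-reverseEdge : (T : Tournament n) {g : Fin k → Fin n} (g-inj : Injective _≡_ _≡_ g)
  {x y : Fin k} {a c : Fin n} (x≢y : x ≢ y) (a≢c : a ≢ c) → g x ≡ a → g y ≡ c →
  reverseEdge (induced T g g-inj) x y x≢y ≈ᵀ induced (reverseEdge T a c a≢c) g g-inj
induced-reverseEdge T {g} g-inj _ _ gx≡a gy≡c i j = cong (adj T (g i) (g j) xor_) (sym
  (cong₂ _∨_ (cong₂ _∧_ (==-injective g-inj gx≡a i) (==-injective g-inj gy≡c j))
             (cong₂ _∧_ (==-injective g-inj gy≡c i) (==-injective g-inj gx≡a j))))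

ReversalClosed : Family → ℕ → Set
ReversalClosed F n =
  ∀ (T : Tournament n) x y (x≢y : x ≢ y) → Free F T → Free F (reverseEdge T x y x≢y)

transitive-< : {i j : Fin n} → i < j → adj (transitive n) i j ≡ true
transitive-< i<j = Equivalence.to Bool.T-≡ (ℕ.<⇒<ᵇ i<j)

TransitiveOutside : Tournament n → List (Fin n × Fin n) → Set
TransitiveOutside T L = ∀ {i j} → i < j → (i , j) ∉ L → adj T i j ≡ true

transitiveOutside-[] : (T : Tournament n) → TransitiveOutside T [] → transitive n ≈ᵀ T
transitiveOutside-[] {n} T out = b-injective {T = transitive n} {T} λ p →
  trans (transitive-< (proj₂ p)) (sym (out (proj₂ p) λ ()))

transitiveOutside-∷ : (T : Tournament n) {x y : Fin n} {L : List (Fin n × Fin n)} →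
  (x < y → adj T x y ≡ true) → TransitiveOutside T ((x , y) ∷ L) → TransitiveOutside T L
transitiveOutside-∷ T {x} {y} xy-true out {i} {j} i<j ij∉L with (i , j) ≟² (x , y)
... | yes refl = xy-true i<j
... | no ij≢xy = out i<j λ { (here ij≡xy) → ij≢xy ij≡xy ; (there ij∈L) → ij∉L ij∈L }

transitiveOutside-reverseEdge : (T : Tournament n) {x y : Fin n} {L : List (Fin n × Fin n)} →
  (x<y : x < y) → adj T x y ≡ false → TransitiveOutside T ((x , y) ∷ L) →
  TransitiveOutside (reverseEdge T x y (<⇒≢ x<y)) L
transitiveOutside-reverseEdge T {x} {y} x<y xy-false out =
  transitiveOutside-∷ (reverseEdge T x y (<⇒≢ x<y))
    (λ _ → cong₂ _xor_ xy-false (isEdge-refl x y)) reversed-out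
  where
  reversed-out : TransitiveOutside (reverseEdge T x y (<⇒≢ x<y)) ((x , y) ∷ _)
  reversed-out {i} {j} i<j ij∉ = trans
    (cong (adj T i j xor_) (isEdge-ordered i<j x<y (ij∉ ∘ here)))
    (trans (Bool.xor-identityʳ (adj T i j)) (out i<j ij∉))

module _ (Tₙ-free : Free F (transitive n)) (closed : ReversalClosed F n) where

  Free-transitiveOutside : ∀ L (T : Tournament n) → TransitiveOutside T L → Free F T
  Free-transitiveOutside [] T out =
    Free-resp-≈ᵀ {T = transitive n} {T} (transitiveOutside-[] T out) Tₙ-free
  Free-transitiveOutside ((x , y) ∷ L) T out with x <? y | adj T x y in xy
  ... | yes x<y | false =
    Free-resp-≈ᵀ {T = reverseEdge T′ x y x≢y} {T} (reverseEdge-involutive T x≢y)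
    (closed T′ x y x≢y (Free-transitiveOutside L T′ (transitiveOutside-reverseEdge T x<y xy out)))
    where
    x≢y = <⇒≢ x<y
    T′ = reverseEdge T x y x≢y
  ... | yes _   | true  = Free-transitiveOutside L T (transitiveOutside-∷ T (λ _ → xy) out)
  ... | no x≮y  | _     = Free-transitiveOutside L T (transitiveOutside-∷ T (⊥-elim ∘ x≮y) out)

  ReversalClosed⇒AllFree : AllFree F n
  ReversalClosed⇒AllFree T = Free-transitiveOutside (cartesianProduct (allFin n) (allFin n)) T
    λ _ ij∉ → ⊥-elim (ij∉ (∈-cartesianProduct⁺ (∈-allFin _) (∈-allFin _)))

FirstEdgeReversible : Family → ℕ → Bool → Set
FirstEdgeReversible F m c = ∀ (U : Tournament (2+ m)) →
  Free F U → adj U 0F 1F ≡ c → Free F (reverseEdge U 0F 1F λ ())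

transpose-fixes : {i j k : Fin n} → k ≢ i → k ≢ j → PC.transpose i j k ≡ k
transpose-fixes {i = i} {j} {k} k≢i k≢j rewrite dec-false (k ≟ i) k≢i | dec-false (k ≟ j) k≢j = refl

-- σ = (0 a) ∘ (1 c′) with c′ = (a 0) c, so that σ 1 = c.
permutation-0↦-1↦ : {a c : Fin (2+ m)} → a ≢ c →
  Σ (Permutation′ (2+ m)) λ σ → σ ⟨$⟩ʳ 0F ≡ a × σ ⟨$⟩ʳ 1F ≡ c
permutation-0↦-1↦ {a = a} {c} a≢c =
  Perm.transpose 1F c′ ∘ₚ Perm.transpose 0F a
  , cong (PC.transpose 0F a) (transpose-fixes {i = 1F} {c′} (λ ()) (c′≢0 ∘ sym))
  , PC.transpose-inverse 0F a
  where
  c′ = PC.transpose a 0F c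
  c′≢0 : c′ ≢ 0F
  c′≢0 c′≡0 = a≢c (trans (sym (cong (PC.transpose 0F a) c′≡0)) (PC.transpose-inverse 0F a))

module _ {c : Bool} (reversible : FirstEdgeReversible F m c) where

  reverseEdge-oriented : (T : Tournament (2+ m)) {x y : Fin (2+ m)} (x≢y : x ≢ y) →
    Free F T → adj T x y ≡ c → Free F (reverseEdge T x y x≢y)
  reverseEdge-oriented T {x} {y} x≢y T-free xy≡c with σ , σ0 , σ1 ← permutation-0↦-1↦ x≢y =
    Free-unpermute (reverseEdge T x y x≢y) σ
      (Free-resp-≈ᵀ {T = reverseEdge (permute T σ) 0F 1F λ ()}
                    {permute (reverseEdge T x y x≢y) σ}
        (induced-reverseEdge T (⟨$⟩ʳ-injective σ) (λ ()) x≢y σ0 σ1)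
        (reversible (permute T σ) (Free-permute T σ T-free) (trans (cong₂ (adj T) σ0 σ1) xy≡c)))

  FirstEdgeReversible⇒ReversalClosed : ReversalClosed F (2+ m)
  FirstEdgeReversible⇒ReversalClosed T x y x≢y T-free with adj T x y Bool.≟ c
  ... | yes xy≡c = reverseEdge-oriented T x≢y T-free xy≡c
  ... | no xy≢c  =
    Free-resp-≈ᵀ {T = reverseEdge T y x y≢x} {reverseEdge T x y x≢y} (reverseEdge-comm T x≢y y≢x)
      (reverseEdge-oriented T y≢x T-free yx≡c)
    where
    y≢x = x≢y ∘ sym
    yx≡c : adj T y x ≡ c
    yx≡c = begin
      adj T y x       ≡⟨ oneEdge T y x y≢x ⟩
      not (adj T x y) ≡⟨ cong not (Bool.¬-not xy≢c) ⟩
      not (not c)     ≡⟨ Bool.not-involutive c ⟩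
      c               ∎
      where open ≡-Reasoning

opposite-< : {x y : Fin n} → x < y → opposite y < opposite x
opposite-< {n} {x} {y} x<y = subst₂ ℕ._<_ (sym (opposite-prop y)) (sym (opposite-prop x))
  (ℕ.∸-monoʳ-< (ℕ.s≤s x<y) (toℕ<n y))

opposite-<ᵇ : ∀ (x y : Fin n) → (toℕ (opposite x) ℕ.<ᵇ toℕ (opposite y)) ≡ (toℕ y ℕ.<ᵇ toℕ x)
opposite-<ᵇ x y = det (ℕ.<ᵇ-reflects-< _ _) (fromEquivalence
  (λ y<x → opposite-< (ℕ.<ᵇ⇒< _ _ y<x))
  (λ ox<oy → ℕ.<⇒<ᵇ (subst₂ _<_ (opposite-involutive y) (opposite-involutive x) (opposite-< ox<oy))))

b-permute-opposite : (σ : Permutation′ n) {i j : Fin n} (i<j : i < j) →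
  b (permute (transitive n) (σ ∘ₚ Perm.reverse)) (_ , i<j)
    ≡ not (b (permute (transitive n) σ) (_ , i<j))
b-permute-opposite {n} σ {i} {j} i<j = trans (opposite-<ᵇ (σ ⟨$⟩ʳ i) (σ ⟨$⟩ʳ j))
  (oneEdge (permute (transitive n) σ) j i (<⇒≢ i<j ∘ sym))

firstEdge : BVec (2+ m)
firstEdge ((i , j) , _) = isEdge 0F 1F i j

b-transpose01 : {i j : Fin (2+ m)} (i<j : i < j) →
  b (permute (transitive (2+ m)) (Perm.transpose 0F 1F)) (_ , i<j) ≡ not (firstEdge (_ , i<j))
b-transpose01 {i = 0F}          {1F}          _   = refl
b-transpose01 {i = 0F}          {suc (suc j)} _   = refl
b-transpose01 {i = 1F}          {suc (suc j)} _   = refl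
b-transpose01 {i = suc (suc i)} {suc (suc j)} i<j = transitive-< i<j
b-transpose01 {i = 0F}          {0F}          ()
b-transpose01 {i = 1F}          {0F}          ()
b-transpose01 {i = 1F}          {1F}          (ℕ.s≤s ())
b-transpose01 {i = suc (suc i)} {0F}          ()
b-transpose01 {i = suc (suc i)} {1F}          (ℕ.s≤s ())

firstEdge-oriented : (U : Tournament (2+ m)) {c : Bool} → adj U 0F 1F ≡ c →
  ∀ p → firstEdge p ≡ true → b U p ≡ c
firstEdge-oriented U U01 ((i , j) , i<j) edge
  with refl ← isEdge-ordered-true i<j (ℕ.s≤s ℕ.z≤n) edge = U01

Free-reverseFirstEdge : (U : Tournament (2+ m)) {w : BVec (2+ m)} → InP F (2+ m) w →
  (∀ p → w p ≡ b U p xor firstEdge p) → Free F (reverseEdge U 0F 1F λ ())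
Free-reverseFirstEdge {F = F} U (T , T-free , bT≡w) w≡ =
  Free-resp-≈ᵀ {F = F} {T = T} {reverseEdge U 0F 1F λ ()}
    (b-injective {T = T} {reverseEdge U 0F 1F λ ()} λ p → trans (bT≡w p) (w≡ p)) T-free

∧-not≗xor : ∀ x e → (e ≡ true → x ≡ true) → x ∧ not e ≡ x xor e
∧-not≗xor true  true  _ = refl
∧-not≗xor false true  e⇒x = e⇒x refl
∧-not≗xor true  false _ = refl
∧-not≗xor false false _ = refl

∨≗xor : ∀ x e → (e ≡ true → x ≡ false) → x ∨ e ≡ x xor e
∨≗xor true  true  e⇒¬x = e⇒¬x refl
∨≗xor false true  _ = refl
∨≗xor true  false _ = refl
∨≗xor false false _ = refl

majority-false : ∀ x y → majority x y false ≡ x ∧ y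
majority-false true  true  = refl
majority-false true  false = refl
majority-false false true  = refl
majority-false false false = refl

minority-not-true : ∀ x e → minority x (not e) true ≡ x xor e
minority-not-true true  true  = refl
minority-not-true true  false = refl
minority-not-true false true  = refl
minority-not-true false false = refl

module _ (Tₙ-free : Free F (transitive n)) where

  InP-permute : (σ : Permutation′ n) {v : BVec n} →
    (∀ {i j} (i<j : i < j) → b (permute (transitive n) σ) (_ , i<j) ≡ v (_ , i<j)) → InP F n v
  InP-permute σ b≡v =
    permute (transitive n) σ , Free-permute (transitive n) σ Tₙ-free , λ p → b≡v (proj₂ p)

  InP-true : InP F n (λ _ → true)
  InP-true = InP-permute Perm.id transitive-<

  InP-false : InP F n (λ _ → false)
  InP-false = InP-permute (Perm.id ∘ₚ Perm.reverse) λ i<j →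
    trans (b-permute-opposite Perm.id i<j) (cong not (transitive-< i<j))

module _ (Tₙ-free : Free F (transitive (2+ m))) where

  InP-notFirstEdge : InP F (2+ m) (not ∘ firstEdge)
  InP-notFirstEdge = InP-permute Tₙ-free (Perm.transpose 0F 1F) b-transpose01

  InP-firstEdge : InP F (2+ m) firstEdge
  InP-firstEdge = InP-permute Tₙ-free (Perm.transpose 0F 1F ∘ₚ Perm.reverse) λ i<j →
    trans (b-permute-opposite (Perm.transpose 0F 1F) i<j)
      (trans (cong not (b-transpose01 i<j)) (Bool.not-involutive _))

  minOp-firstEdgeReversible : Preserves₂ minOp F (2+ m) → FirstEdgeReversible F m true
  minOp-firstEdgeReversible preserves U U-free U01 = Free-reverseFirstEdge U
    (preserves (b U) (not ∘ firstEdge) (Free⇒InP {T = U} U-free) InP-notFirstEdge)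
    λ p → ∧-not≗xor (b U p) (firstEdge p) (firstEdge-oriented U U01 p)

  maxOp-firstEdgeReversible : Preserves₂ maxOp F (2+ m) → FirstEdgeReversible F m false
  maxOp-firstEdgeReversible preserves U U-free U01 = Free-reverseFirstEdge U
    (preserves (b U) firstEdge (Free⇒InP {T = U} U-free) InP-firstEdge)
    λ p → ∨≗xor (b U p) (firstEdge p) (firstEdge-oriented U U01 p)

  majority-firstEdgeReversible : Preserves₃ majority F (2+ m) → FirstEdgeReversible F m true
  majority-firstEdgeReversible preserves U U-free U01 = Free-reverseFirstEdge U
    (preserves (b U) (not ∘ firstEdge) (λ _ → false)
      (Free⇒InP {T = U} U-free) InP-notFirstEdge (InP-false Tₙ-free))
    λ p → trans (majority-false (b U p) _)
      (∧-not≗xor (b U p) (firstEdge p) (firstEdge-oriented U U01 p))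

  minority-firstEdgeReversible : Preserves₃ minority F (2+ m) → FirstEdgeReversible F m true
  minority-firstEdgeReversible preserves U U-free _ = Free-reverseFirstEdge U
    (preserves (b U) (not ∘ firstEdge) (λ _ → true)
      (Free⇒InP {T = U} U-free) InP-notFirstEdge (InP-true Tₙ-free))
    λ p → minority-not-true (b U p) (firstEdge p)

FirstEdgeReversible⇒AllFree : Free F (transitive n) → (P : ℕ → Set) (c : Bool) →
  (∀ {m} → Free F (transitive (2+ m)) → P (2+ m) → FirstEdgeReversible F m c) →
  P n → AllFree F n
FirstEdgeReversible⇒AllFree {n = 0}    Tₙ-free _ _ _ _ =
  ReversalClosed⇒AllFree Tₙ-free λ _ ()
FirstEdgeReversible⇒AllFree {n = 1}    Tₙ-free _ _ _ _ =
  ReversalClosed⇒AllFree Tₙ-free λ { _ 0F 0F 0≢0 _ → ⊥-elim (0≢0 refl) }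
FirstEdgeReversible⇒AllFree {n = 2+ m} Tₙ-free _ _ reversible Pₙ =
  ReversalClosed⇒AllFree Tₙ-free (FirstEdgeReversible⇒ReversalClosed (reversible Tₙ-free Pₙ))

lemma4p10 : (F : Family) → All (λ S → 2 ≤ proj₁ S) F →
    (n : ℕ) → 1 ≤ n → n ≤ mF F → Free F (transitive n) →
    (AllFree F n ⇔ Pfull F n) ×
    (AllFree F n ⇔ Preserves₂ minOp F n) ×
    (AllFree F n ⇔ Preserves₂ maxOp F n) ×
    (AllFree F n ⇔ Preserves₃ majority F n) ×
    (AllFree F n ⇔ Preserves₃ minority F n)
lemma4p10 F _ n _ _ Tₙ-free =
    mk⇔ AllFree⇒Pfull Pfull⇒AllFree
  , mk⇔ (λ all-free _ _ _ _ → AllFree⇒Pfull all-free _)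
        (FirstEdgeReversible⇒AllFree Tₙ-free (Preserves₂ minOp F) true minOp-firstEdgeReversible)
  , mk⇔ (λ all-free _ _ _ _ → AllFree⇒Pfull all-free _)
        (FirstEdgeReversible⇒AllFree Tₙ-free (Preserves₂ maxOp F) false maxOp-firstEdgeReversible)
  , mk⇔ (λ all-free _ _ _ _ _ _ → AllFree⇒Pfull all-free _)
        (FirstEdgeReversible⇒AllFree Tₙ-free (Preserves₃ majority F) true majority-firstEdgeReversible)
  , mk⇔ (λ all-free _ _ _ _ _ _ → AllFree⇒Pfull all-free _)
        (FirstEdgeReversible⇒AllFree Tₙ-free (Preserves₃ minority F) true minority-firstEdgeReversible)
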